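{- Let $K$ be an infinite field. Then $K$ satisfies at most one of the following: (1) $K$ is ACVF-like; (2) $K$ is $p$CF-like for some prime $p$; (3) $K$ is RCVF-like. Moreover, in case (2) the prime $p$ is uniquely determined.
   Context: An infinite field $K$ is ACVF-like if there is a henselian valuation on $K$ (possibly trivial) with algebraically closed residue field; $p$CF-like if there is a henselian valuation on $K$ (possibly trivial) with finite residue field of characteristic $p$; RCVF-like if there is a henselian valuation on $K$ (possibly trivial) with real closed residue field. -}

module Defs where

open import Level using (Level; _⊔_; suc)
open import Algebra.Bundles using (CommutativeRing)
open import Data.Nat as ℕ using (ℕ; zero; _<_) renaming (suc to 1+)
open import Data.Nat.Primality using (Prime)
open import Data.Fin using (Fin)
open import Data.List using (List; []; _∷_; _++_; [_]; length)
open import Data.List.Relation.Unary.All using (All)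
open import Data.Product using (Σ; ∃; _×_; _,_)
open import Data.Sum using (_⊎_)
open import Relation.Nullary using (¬_)
open import Relation.Binary.PropositionalEquality using (_≡_)

Oddℕ : ℕ → Set
Oddℕ n = ∃ λ k → n ≡ 1+ (k ℕ.+ k)

record Field (c ℓ : Level) : Set (suc (c ⊔ ℓ)) where
  field
    commutativeRing : CommutativeRing c ℓ
  open CommutativeRing commutativeRing public
  field
    0≉1     : ¬ (0# ≈ 1#)
    inverse : ∀ x → ¬ (x ≈ 0#) → ∃ λ y → x * y ≈ 1#

module _ {a ℓ : Level} (A : Set a) (_~_ : A → A → Set ℓ) where
  FiniteUpTo : Set (a ⊔ ℓ)
  FiniteUpTo = ∃ λ (n : ℕ) → Σ (Fin n → A) λ f → ∀ x → ∃ λ i → f i ~ x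

module FieldTheory {c ℓ : Level} (K : Field c ℓ) where
  open Field K

  Infinite : Set (c ⊔ ℓ)
  Infinite = ¬ FiniteUpTo Carrier _≈_

  ι : ℕ → Carrier
  ι zero     = 0#
  ι (1+ n)   = 1# + ι n

  -- polynomials as coefficient lists, lowest degree first
  eval : List Carrier → Carrier → Carrier
  eval []       x = 0#
  eval (a ∷ as) x = a + x * eval as x

  -- formal derivative: d/dX (Σ aᵢ Xⁱ) = Σ i·aᵢ Xⁱ⁻¹
  private
    deriv-from : ℕ → List Carrier → List Carrier
    deriv-from n []       = []
    deriv-from n (b ∷ bs) = (ι n * b) ∷ deriv-from (1+ n) bs

  deriv : List Carrier → List Carrier
  deriv []       = []
  deriv (a ∷ as) = deriv-from 1 as

  -- monic polynomial X^n + a_{n-1} X^{n-1} + ... + a_0 given by (a_0 … a_{n-1})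
  monic : List Carrier → List Carrier
  monic as = as ++ [ 1# ]

  sumSq : List Carrier → Carrier
  sumSq []       = 0#
  sumSq (x ∷ xs) = x * x + sumSq xs

  -- Valuations on K, presented by their valuation rings O ⊆ K
  -- (subsets given as predicates of level ℓ′).  O = K is the trivial
  -- valuation.

  record ValuationRing (ℓ′ : Level) : Set (c ⊔ ℓ ⊔ suc ℓ′) where
    field
      O      : Carrier → Set ℓ′
      O-resp : ∀ {x y} → x ≈ y → O x → O y
      O-1    : O 1#
      O-+    : ∀ {x y} → O x → O y → O (x + y)
      O-*    : ∀ {x y} → O x → O y → O (x * y)
      O-neg  : ∀ {x} → O x → O (- x)
      -- for every x ≠ 0, x ∈ O or x⁻¹ ∈ O
      O-val  : ∀ x y → x * y ≈ 1# → O x ⊎ O y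

    𝔪 : Carrier → Set (c ⊔ ℓ ⊔ ℓ′)
    𝔪 x = O x × ¬ (∃ λ y → O y × x * y ≈ 1#)

    -- equality in the residue field k = O/𝔪 (on representatives in O)
    _≡ₖ_ : Carrier → Carrier → Set (c ⊔ ℓ ⊔ ℓ′)
    x ≡ₖ y = 𝔪 (x - y)

    Res : Set (c ⊔ ℓ′)
    Res = Σ Carrier O

    _≈ᵣ_ : Res → Res → Set (c ⊔ ℓ ⊔ ℓ′)
    (x , _) ≈ᵣ (y , _) = x ≡ₖ y

    Henselian : Set (c ⊔ ℓ ⊔ ℓ′)
    Henselian = ∀ (as : List Carrier) → All O as → ∀ a → O a →
      𝔪 (eval (monic as) a) → ¬ 𝔪 (eval (deriv (monic as)) a) →
      ∃ λ b → O b × eval (monic as) b ≈ 0# × 𝔪 (b - a)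

    ResidueAlgClosed : Set (c ⊔ ℓ ⊔ ℓ′)
    ResidueAlgClosed = ∀ (as : List Carrier) → All O as → 0 < length as →
      ∃ λ b → O b × 𝔪 (eval (monic as) b)

    ResidueFinite : Set (c ⊔ ℓ ⊔ ℓ′)
    ResidueFinite = FiniteUpTo Res _≈ᵣ_

    ResidueChar : ℕ → Set (c ⊔ ℓ ⊔ ℓ′)
    ResidueChar p = 0 < p × 𝔪 (ι p) × (∀ n → 0 < n → n < p → ¬ 𝔪 (ι n))

    -- residue field real closed (Artin–Schreier): k is formally real
    -- (-1 is not a sum of squares), every element or its negative is a
    -- square, and every monic polynomial of odd degree has a root.
    ResidueRealClosed : Set (c ⊔ ℓ ⊔ ℓ′)
    ResidueRealClosed =
      (∀ (xs : List Carrier) → All O xs → ¬ 𝔪 (sumSq xs + 1#)) ×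
      (∀ x → O x → ∃ λ y → O y × (𝔪 (y * y - x) ⊎ 𝔪 (y * y + x))) ×
      (∀ (as : List Carrier) → All O as → Oddℕ (length as) →
        ∃ λ b → O b × 𝔪 (eval (monic as) b))

  ACVF-like : (ℓ′ : Level) → Set (c ⊔ ℓ ⊔ suc ℓ′)
  ACVF-like ℓ′ = Infinite × ∃ λ (V : ValuationRing ℓ′) →
    ValuationRing.Henselian V × ValuationRing.ResidueAlgClosed V

  pCF-like : (ℓ′ : Level) → ℕ → Set (c ⊔ ℓ ⊔ suc ℓ′)
  pCF-like ℓ′ p = Infinite × ∃ λ (V : ValuationRing ℓ′) →
    ValuationRing.Henselian V × ValuationRing.ResidueFinite V ×
    ValuationRing.ResidueChar V p

  RCVF-like : (ℓ′ : Level) → Set (c ⊔ ℓ ⊔ suc ℓ′)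
  RCVF-like ℓ′ = Infinite × ∃ λ (V : ValuationRing ℓ′) →
    ValuationRing.Henselian V × ValuationRing.ResidueRealClosed V

  somePCF-like : (ℓ′ : Level) → Set (c ⊔ ℓ ⊔ suc ℓ′)
  somePCF-like ℓ′ = ∃ λ p → Prime p × pCF-like ℓ′ p

{-# OPTIONS --safe #-}
-- Roots in K of monic polynomials over a valuation ring O lie in O, and Hensel's lemma lifts
-- simple residue roots; so for an algebraically closed residue field, a monic polynomial over O
-- without roots in K has a multiple residue root.  A finite residue field of size n gives
-- b^(M+1) ≡ b for b ∈ O and n! ∣ M, so X^(M+1) − X − c has no root in K when c is a unit; a
-- formally real residue field excludes roots of monic quadratics of discriminant −(m + 1).
-- Multiple residue roots of X^(M+1) − X + 1 yield a positive residue characteristic N and then,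
-- for N ∣ M, the contradiction −1 ≡ 0; those of X² + 1 and X² + X + 1 yield 4 ≡ 0 ≡ 3.  A residue
-- field of characteristic p lifts the simple root 0 of X² + X + p, whose discriminant 1 − 4p is
-- negative, and that of X^(M+1) − X − p, which has no root if p is a unit for another valuation
-- with finite residue field.
module Submission where

open import Defs

open import Level using (Level; _⊔_)
open import Algebra.Bundles using (CommutativeRing)
open import Data.Nat as ℕ using (ℕ; zero; suc; _<_; _!)
open import Data.List using (List; []; _∷_; replicate; length)
import Data.List.Relation.Unary.All.Properties as All
open import Data.List.Relation.Unary.All using (All; []; _∷_)
open import Data.Integer as ℤ using (ℤ; +_; -[1+_]; _⊖_; sign; ∣_∣; _◃_)
import Data.Integer.Properties as ℤ
import Data.Nat.Properties as ℕ
open import Data.Nat.DivMod using (_%_; _/_; m≡m%n+[m/n]*n; m%n<n)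
open import Data.Nat.Divisibility using (_∣_; divides; ∣-refl; ∣-trans; m∣m*n; m≤n⇒m!∣n!; m%n≡0⇒n∣m)
open import Data.Fin as Fin using (Fin; toℕ)
open import Data.Fin.Properties using (pigeonhole; toℕ≤pred[n])
open import Data.Sign as Sign using (Sign)
open import Data.Maybe using (Maybe; just; nothing)
open import Relation.Nullary using (yes; no; ¬_)
open import Data.Empty using (⊥; ⊥-elim)
open import Data.Sum using (inj₁; inj₂; [_,_]′)
open import Data.Product using (∃; ∃₂; _×_; _,_; proj₁; proj₂)
open import Data.Nat.Primality using (Prime; prime⇒irreducible)
open import Function using (id)
import Relation.Binary.PropositionalEquality as ≡
open ≡ using (_≡_)
import Algebra.Solver.Ring
open import Algebra.Solver.Ring.AlmostCommutativeRing
  using (fromCommutativeRing; _-Raw-AlmostCommutative⟶_)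

module IntegerCoefficients {c ℓ : Level} (R : CommutativeRing c ℓ) where
  open CommutativeRing R
  open import Algebra.Properties.Ring ring
    using (-‿involutive; -0#≈0#; -‿+-comm; -1*x≈-x)
  open import Algebra.Properties.Semiring.Mult.TCOptimised semiring
    using (1+×; ×-homo-+; ×1-homo-*) renaming (_×_ to _×′_)
  open import Algebra.Properties.CommutativeSemigroup *-commutativeSemigroup using (interchange)
  open import Relation.Binary.Reasoning.Setoid setoid

  -- As 1 ×′ x = x, the solver term :1 below denotes 1# itself, and for a numeral n the term
  -- :ι n denotes 1# + (… + (1# + 0#)), which is ι n on the nose.
  fromℤ : ℤ → Carrier
  fromℤ (+ n)    = n ×′ 1#
  fromℤ -[1+ n ] = - (suc n ×′ 1#)

  fromSign : Sign → Carrier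
  fromSign Sign.+ = 1#
  fromSign Sign.- = - 1#

  fromℤ-neg : ∀ i → fromℤ (ℤ.- i) ≈ - fromℤ i
  fromℤ-neg (+ zero)  = sym -0#≈0#
  fromℤ-neg (+ suc n) = refl
  fromℤ-neg -[1+ n ]  = sym (-‿involutive _)

  fromℤ-⊖ : ∀ m n → fromℤ (m ⊖ n) ≈ m ×′ 1# - n ×′ 1#
  fromℤ-⊖ zero    zero    = sym (-‿inverseʳ 0#)
  fromℤ-⊖ (suc m) zero    = begin
    fromℤ (suc m ⊖ 0)   ≡⟨ ≡.cong fromℤ (ℤ.⊖-≥ {suc m} {0} ℕ.z≤n) ⟩
    suc m ×′ 1#         ≈⟨ +-identityʳ _ ⟨
    suc m ×′ 1# + 0#    ≈⟨ +-congˡ -0#≈0# ⟨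
    suc m ×′ 1# - 0#    ∎
  fromℤ-⊖ zero    (suc n) = begin
    fromℤ (0 ⊖ suc n)   ≡⟨ ≡.cong fromℤ (ℤ.⊖-< {0} {suc n} ℕ.z<s) ⟩
    - (suc n ×′ 1#)     ≈⟨ +-identityˡ _ ⟨
    0# - suc n ×′ 1#    ∎
  fromℤ-⊖ (suc m) (suc n) = begin
    fromℤ (suc m ⊖ suc n)               ≡⟨ ≡.cong fromℤ (ℤ.[1+m]⊖[1+n]≡m⊖n m n) ⟩
    fromℤ (m ⊖ n)                       ≈⟨ fromℤ-⊖ m n ⟩
    m ×′ 1# - n ×′ 1#                   ≈⟨ +-identityˡ _ ⟨
    0# + (m ×′ 1# - n ×′ 1#)            ≈⟨ +-congʳ (-‿inverseʳ 1#) ⟨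
    (1# - 1#) + (m ×′ 1# - n ×′ 1#)     ≈⟨ interchange⁺ 1# (- 1#) (m ×′ 1#) (- (n ×′ 1#)) ⟩
    (1# + m ×′ 1#) + (- 1# - n ×′ 1#)   ≈⟨ +-congˡ (-‿+-comm 1# (n ×′ 1#)) ⟩
    (1# + m ×′ 1#) - (1# + n ×′ 1#)     ≈⟨ +-cong (1+× m 1#) (-‿cong (1+× n 1#)) ⟨
    suc m ×′ 1# - suc n ×′ 1#           ∎
    where open import Algebra.Properties.CommutativeSemigroup +-commutativeSemigroup
            renaming (interchange to interchange⁺)

  fromℤ-+ : ∀ i j → fromℤ (i ℤ.+ j) ≈ fromℤ i + fromℤ j
  fromℤ-+ -[1+ m ] -[1+ n ] = begin
    - (suc (suc (m ℕ.+ n)) ×′ 1#)     ≡⟨ ≡.cong (λ k → - (suc k ×′ 1#)) (≡.sym (ℕ.+-suc m n)) ⟩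
    - ((suc m ℕ.+ suc n) ×′ 1#)       ≈⟨ -‿cong (×-homo-+ 1# (suc m) (suc n)) ⟩
    - (suc m ×′ 1# + suc n ×′ 1#)     ≈⟨ -‿+-comm _ _ ⟨
    - (suc m ×′ 1#) + - (suc n ×′ 1#) ∎
  fromℤ-+ -[1+ m ] (+ n)    = trans (fromℤ-⊖ n (suc m)) (+-comm _ _)
  fromℤ-+ (+ m)    -[1+ n ] = fromℤ-⊖ m (suc n)
  fromℤ-+ (+ m)    (+ n)    = ×-homo-+ 1# m n

  fromℤ-◃ : ∀ s n → fromℤ (s ◃ n) ≈ fromSign s * n ×′ 1#
  fromℤ-◃ s       zero    = sym (zeroʳ _)
  fromℤ-◃ Sign.+ (suc n) = sym (*-identityˡ _)
  fromℤ-◃ Sign.- (suc n) = sym (-1*x≈-x _)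

  fromSign-* : ∀ s t → fromSign (s Sign.* t) ≈ fromSign s * fromSign t
  fromSign-* Sign.+ t      = sym (*-identityˡ _)
  fromSign-* Sign.- Sign.+ = sym (*-identityʳ _)
  fromSign-* Sign.- Sign.- = begin
    1#          ≈⟨ -‿involutive 1# ⟨
    - - 1#      ≈⟨ -1*x≈-x (- 1#) ⟨
    - 1# * - 1# ∎

  fromℤ-* : ∀ i j → fromℤ (i ℤ.* j) ≈ fromℤ i * fromℤ j
  fromℤ-* i j = begin
    fromℤ (sign i Sign.* sign j ◃ ∣ i ∣ ℕ.* ∣ j ∣)
      ≈⟨ fromℤ-◃ (sign i Sign.* sign j) (∣ i ∣ ℕ.* ∣ j ∣) ⟩
    fromSign (sign i Sign.* sign j) * (∣ i ∣ ℕ.* ∣ j ∣) ×′ 1#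
      ≈⟨ *-cong (fromSign-* (sign i) (sign j)) (×1-homo-* ∣ i ∣ ∣ j ∣) ⟩
    (fromSign (sign i) * fromSign (sign j)) * (∣ i ∣ ×′ 1# * ∣ j ∣ ×′ 1#)
      ≈⟨ interchange _ _ _ _ ⟩
    (fromSign (sign i) * ∣ i ∣ ×′ 1#) * (fromSign (sign j) * ∣ j ∣ ×′ 1#)
      ≈⟨ *-cong (fromℤ-◃ (sign i) ∣ i ∣) (fromℤ-◃ (sign j) ∣ j ∣) ⟨
    fromℤ (sign i ◃ ∣ i ∣) * fromℤ (sign j ◃ ∣ j ∣)
      ≡⟨ ≡.cong₂ (λ a b → fromℤ a * fromℤ b) (ℤ.◃-inverse i) (ℤ.◃-inverse j) ⟩
    fromℤ i * fromℤ j
      ∎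

  morphism : ℤ.+-*-rawRing -Raw-AlmostCommutative⟶ fromCommutativeRing R
  morphism = record
    { ⟦_⟧    = fromℤ
    ; +-homo = fromℤ-+
    ; *-homo = fromℤ-*
    ; -‿homo = fromℤ-neg
    ; 0-homo = refl
    ; 1-homo = refl
    }

  fromℤ-≟ : ∀ i j → Maybe (fromℤ i ≈ fromℤ j)
  fromℤ-≟ i j with i ℤ.≟ j
  ... | yes ≡.refl = just refl
  ... | no _       = nothing

  module Solver = Algebra.Solver.Ring ℤ.+-*-rawRing (fromCommutativeRing R) morphism fromℤ-≟
  open Solver public using (Polynomial; solve; _:=_; _:+_; _:*_; _:-_; :-_)

  :0 :1 : ∀ {k} → Polynomial k
  :0 = Solver.con (+ 0)
  :1 = Solver.con (+ 1)

  :ι : ∀ {k} → ℕ → Polynomial k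
  :ι n = n Solver.:× :1

module _ {c ℓ : Level} (K : Field c ℓ) where
  open Field K
  open FieldTheory K
  open IntegerCoefficients commutativeRing
  open import Algebra.Properties.Ring ring using (-‿distribʳ-*; -‿involutive)
  open import Algebra.Properties.Semiring.Exp semiring using (_^_; ^-homo-*; ^-assocʳ; ^-congˡ; ^-congʳ)
  open import Algebra.Properties.CommutativeSemiring.Exp commutativeSemiring using (^-distrib-*)
  open import Relation.Binary.Reasoning.Setoid setoid

  ι-+ : ∀ m n → ι (m ℕ.+ n) ≈ ι m + ι n
  ι-+ zero    n = sym (+-identityˡ _)
  ι-+ (suc m) n = trans (+-congˡ (ι-+ m n)) (sym (+-assoc _ _ _))

  ι-* : ∀ m n → ι (m ℕ.* n) ≈ ι m * ι n
  ι-* zero    n = sym (zeroˡ _)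
  ι-* (suc m) n = begin
    ι (n ℕ.+ m ℕ.* n)     ≈⟨ ι-+ n (m ℕ.* n) ⟩
    ι n + ι (m ℕ.* n)     ≈⟨ +-cong (sym (*-identityˡ _)) (ι-* m n) ⟩
    1# * ι n + ι m * ι n  ≈⟨ distribʳ _ _ _ ⟨
    (1# + ι m) * ι n      ∎

  ι-^ : ∀ m n → ι (m ℕ.^ n) ≈ ι m ^ n
  ι-^ m zero    = +-identityʳ 1#
  ι-^ m (suc n) = trans (ι-* m (m ℕ.^ n)) (*-congˡ (ι-^ m n))

  1^n≈1 : ∀ n → 1# ^ n ≈ 1#
  1^n≈1 zero    = refl
  1^n≈1 (suc n) = trans (*-identityˡ _) (1^n≈1 n)

  eval-cong : ∀ as {x y} → x ≈ y → eval as x ≈ eval as y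
  eval-cong []       x≈y = refl
  eval-cong (a ∷ as) x≈y = +-congˡ (*-cong x≈y (eval-cong as x≈y))

  eval-0 : ∀ a as → eval (a ∷ as) 0# ≈ a
  eval-0 a as = trans (+-congˡ (zeroˡ _)) (+-identityʳ a)

  eval-deriv-0 : ∀ a as → eval (deriv (a ∷ as)) 0# ≈ eval as 0#
  eval-deriv-0 a []       = refl
  eval-deriv-0 a (b ∷ bs) = begin
    eval (deriv (a ∷ b ∷ bs)) 0# ≈⟨ trans (+-congˡ (zeroˡ _)) (+-identityʳ _) ⟩
    ι 1 * b                      ≈⟨ *-congʳ (+-identityʳ 1#) ⟩
    1# * b                       ≈⟨ *-identityˡ b ⟩
    b                            ≈⟨ eval-0 b bs ⟨
    eval (b ∷ bs) 0#             ∎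

  evalDeriv : List Carrier → Carrier → Carrier
  evalDeriv []       x = 0#
  evalDeriv (a ∷ as) x = eval as x + x * evalDeriv as x

  eval-Xⁿ : ∀ n x → eval (monic (replicate n 0#)) x ≈ x ^ n
  eval-Xⁿ zero    x = trans (+-congˡ (zeroʳ x)) (+-identityʳ 1#)
  eval-Xⁿ (suc n) x = trans (+-identityˡ _) (*-congˡ (eval-Xⁿ n x))

  X*evalDeriv-Xⁿ : ∀ n x → x * evalDeriv (monic (replicate n 0#)) x ≈ ι n * x ^ n
  X*evalDeriv-Xⁿ zero    x = solve 1 (λ x → x :* (:0 :+ x :* :0) := :0 :* :1) refl x
  X*evalDeriv-Xⁿ (suc n) x = begin
    x * (eval (monic (replicate n 0#)) x + x * evalDeriv (monic (replicate n 0#)) x)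
      ≈⟨ *-congˡ (+-cong (eval-Xⁿ n x) (X*evalDeriv-Xⁿ n x)) ⟩
    x * (x ^ n + ι n * x ^ n)
      ≈⟨ solve 3 (λ x X N → x :* (X :+ N :* X) := (:1 :+ N) :* (x :* X)) refl x (x ^ n) (ι n) ⟩
    (1# + ι n) * (x * x ^ n)
      ∎

  shiftStep : Carrier → Carrier → List Carrier → List Carrier
  shiftStep a p []       = p + a ∷ []
  shiftStep a p (d ∷ ds) = p + a * d ∷ shiftStep a d ds

  taylor : Carrier → List Carrier → List Carrier
  taylor a []       = []
  taylor a (p ∷ ps) = shiftStep a p (taylor a ps)

  eval-shiftStep : ∀ a p g t → eval (monic (shiftStep a p g)) t ≈ p + (t + a) * eval (monic g) t
  eval-shiftStep a p []       t =
    solve 3 (λ a p t → (p :+ a) :+ t :* (:1 :+ t :* :0)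
                     := p :+ (t :+ a) :* (:1 :+ t :* :0)) refl a p t
  eval-shiftStep a p (d ∷ ds) t = begin
    (p + a * d) + t * eval (monic (shiftStep a d ds)) t ≈⟨ +-congˡ (*-congˡ (eval-shiftStep a d ds t)) ⟩
    (p + a * d) + t * (d + (t + a) * E)                 ≈⟨ solve 5 (λ a p t d E →
                                                             (p :+ a :* d) :+ t :* (d :+ (t :+ a) :* E)
                                                               := p :+ (t :+ a) :* (d :+ t :* E)) refl a p t d E ⟩
    p + (t + a) * (d + t * E)                           ∎
    where E = eval (monic ds) t

  eval-taylor : ∀ a as t → eval (monic (taylor a as)) t ≈ eval (monic as) (t + a)
  eval-taylor a []       t = +-congˡ (trans (zeroʳ t) (sym (zeroʳ (t + a))))
  eval-taylor a (p ∷ ps) t =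
    trans (eval-shiftStep a p (taylor a ps) t) (+-congˡ (*-congˡ (eval-taylor a ps t)))

  deriv₀-shiftStep : ∀ a p g → eval (deriv (monic (shiftStep a p g))) 0# ≈
                     eval (monic g) 0# + a * eval (deriv (monic g)) 0#
  deriv₀-shiftStep a p []       = begin
    eval (deriv (p + a ∷ 1# ∷ [])) 0# ≈⟨ eval-deriv-0 (p + a) (1# ∷ []) ⟩
    eval (1# ∷ []) 0#                 ≈⟨ +-identityʳ _ ⟨
    eval (1# ∷ []) 0# + 0#            ≈⟨ +-congˡ (zeroʳ a) ⟨
    eval (1# ∷ []) 0# + a * 0#        ∎
  deriv₀-shiftStep a p (d ∷ ds) = begin
    eval (deriv (monic (shiftStep a p (d ∷ ds)))) 0#
      ≈⟨ eval-deriv-0 (p + a * d) (monic (shiftStep a d ds)) ⟩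
    eval (monic (shiftStep a d ds)) 0#
      ≈⟨ eval-shiftStep a d ds 0# ⟩
    d + (0# + a) * eval (monic ds) 0#
      ≈⟨ +-congˡ (*-congʳ (+-identityˡ a)) ⟩
    d + a * eval (monic ds) 0#
      ≈⟨ +-cong (eval-0 d (monic ds)) (*-congˡ (eval-deriv-0 d (monic ds))) ⟨
    eval (monic (d ∷ ds)) 0# + a * eval (deriv (monic (d ∷ ds))) 0#
      ∎

  deriv₀-taylor : ∀ a as → eval (deriv (monic (taylor a as))) 0# ≈ evalDeriv (monic as) a
  deriv₀-taylor a []       = sym (trans (+-identityˡ _) (zeroʳ a))
  deriv₀-taylor a (p ∷ ps) = begin
    eval (deriv (monic (shiftStep a p (taylor a ps)))) 0#
      ≈⟨ deriv₀-shiftStep a p (taylor a ps) ⟩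
    eval (monic (taylor a ps)) 0# + a * eval (deriv (monic (taylor a ps))) 0#
      ≈⟨ +-cong (eval-taylor a ps 0#) (*-congˡ (deriv₀-taylor a ps)) ⟩
    eval (monic ps) (0# + a) + a * evalDeriv (monic ps) a
      ≈⟨ +-congʳ (eval-cong (monic ps) (+-identityˡ a)) ⟩
    evalDeriv (monic (p ∷ ps)) a
      ∎

  trinomial : ℕ → Carrier → List Carrier
  trinomial m c = - c ∷ - 1# ∷ replicate m 0#

  eval-trinomial : ∀ m c x → eval (monic (trinomial m c)) x ≈ x * x ^ suc m - x - c
  eval-trinomial m c x = begin
    - c + x * (- 1# + x * eval (monic (replicate m 0#)) x) ≈⟨ +-congˡ (*-congˡ (+-congˡ (*-congˡ (eval-Xⁿ m x)))) ⟩
    - c + x * (- 1# + x * x ^ m)                           ≈⟨ solve 3 (λ c x X → :- c :+ x :* (:- :1 :+ x :* X)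
                                                                            := x :* (x :* X) :- x :- c) refl c x (x ^ m) ⟩
    x * (x * x ^ m) - x - c                                ∎

  evalDeriv-trinomial : ∀ m c x → evalDeriv (monic (trinomial m c)) x ≈ ι (2 ℕ.+ m) * x ^ suc m - 1#
  evalDeriv-trinomial m c x = begin
    (- 1# + x * E) + x * (E + x * evalDeriv (monic (replicate m 0#)) x)
      ≈⟨ +-cong (+-congˡ (*-congˡ (eval-Xⁿ m x))) (*-congˡ (+-cong (eval-Xⁿ m x) (X*evalDeriv-Xⁿ m x))) ⟩
    (- 1# + x * x ^ m) + x * (x ^ m + ι m * x ^ m)
      ≈⟨ solve 3 (λ x X N → (:- :1 :+ x :* X) :+ x :* (X :+ N :* X) := (:1 :+ (:1 :+ N)) :* (x :* X) :- :1)
                 refl x (x ^ m) (ι m) ⟩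
    ι (2 ℕ.+ m) * (x * x ^ m) - 1#
      ∎
    where E = eval (monic (replicate m 0#)) x

  discriminant : Carrier → Carrier → Carrier
  discriminant β γ = β * β - ι 4 * γ

  completeSquare : ∀ β γ x → ι 4 * eval (monic (γ ∷ β ∷ [])) x ≈
                   (ι 2 * x + β) * (ι 2 * x + β) - discriminant β γ
  completeSquare = solve 3 (λ β γ x → :ι 4 :* (γ :+ x :* (β :+ x :* (:1 :+ x :* :0)))
                          := (:ι 2 :* x :+ β) :* (:ι 2 :* x :+ β) :- (β :* β :- :ι 4 :* γ)) refl

  evalDeriv-quadratic : ∀ β γ x → evalDeriv (monic (γ ∷ β ∷ [])) x ≈ ι 2 * x + β
  evalDeriv-quadratic = solve 3 (λ β γ x →
    (β :+ x :* (:1 :+ x :* :0)) :+ x :* ((:1 :+ x :* :0) :+ x :* (:0 :+ x :* :0))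
                                := :ι 2 :* x :+ β) refl

  module Valuation {ℓ′ : Level} (V : ValuationRing ℓ′) where
    open ValuationRing V public

    O-0 : O 0#
    O-0 = O-resp (-‿inverseʳ 1#) (O-+ O-1 (O-neg O-1))

    O-ι : ∀ n → O (ι n)
    O-ι zero    = O-0
    O-ι (suc n) = O-+ O-1 (O-ι n)

    O-^ : ∀ {x} n → O x → O (x ^ n)
    O-^ zero    _  = O-1
    O-^ (suc n) ox = O-* ox (O-^ n ox)

    O-sub : ∀ {x y} → O x → O y → O (x - y)
    O-sub ox oy = O-+ ox (O-neg oy)

    O-eval : ∀ {as x} → All O as → O x → O (eval as x)
    O-eval []         ox = O-0
    O-eval (oa ∷ oas) ox = O-+ oa (O-* ox (O-eval oas ox))

    O-evalDeriv : ∀ {as x} → All O as → O x → O (evalDeriv as x)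
    O-evalDeriv []         ox = O-0
    O-evalDeriv (_ ∷ oas)  ox = O-+ (O-eval oas ox) (O-* ox (O-evalDeriv oas ox))

    O-monic : ∀ {as} → All O as → All O (monic as)
    O-monic oas = All.++⁺ oas (O-1 ∷ [])

    O-shiftStep : ∀ {a p g} → O a → O p → All O g → All O (shiftStep a p g)
    O-shiftStep oa op []         = O-+ op oa ∷ []
    O-shiftStep oa op (od ∷ ods) = O-+ op (O-* oa od) ∷ O-shiftStep oa od ods

    O-taylor : ∀ {a as} → O a → All O as → All O (taylor a as)
    O-taylor oa []         = []
    O-taylor oa (op ∷ ops) = O-shiftStep oa op (O-taylor oa ops)

    O-trinomial : ∀ m {c} → O c → All O (trinomial m c)
    O-trinomial m oc = O-neg oc ∷ O-neg O-1 ∷ All.replicate⁺ m O-0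

    𝔪⇒O : ∀ {x} → 𝔪 x → O x
    𝔪⇒O = proj₁

    𝔪-resp : ∀ {x y} → x ≈ y → 𝔪 x → 𝔪 y
    𝔪-resp x≈y (ox , nonunit) =
      O-resp x≈y ox , λ (u , ou , yu≈1) → nonunit (u , ou , trans (*-congʳ x≈y) yu≈1)

    𝔪-stable : ∀ {x} → O x → ¬ ¬ 𝔪 x → 𝔪 x
    𝔪-stable ox ¬¬𝔪x = ox , λ unit → ¬¬𝔪x (λ (_ , nonunit) → nonunit unit)

    ≈0⇒𝔪 : ∀ {x} → x ≈ 0# → 𝔪 x
    ≈0⇒𝔪 x≈0 = O-resp (sym x≈0) O-0 ,
      λ (u , _ , xu≈1) → 0≉1 (trans (sym (zeroˡ u)) (trans (*-congʳ (sym x≈0)) xu≈1))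

    ≈1⇒∉𝔪 : ∀ {x} → x ≈ 1# → ¬ 𝔪 x
    ≈1⇒∉𝔪 x≈1 (_ , nonunit) = nonunit (1# , O-1 , trans (*-identityʳ _) x≈1)

    𝔪-*ʳ : ∀ {x y} → 𝔪 x → O y → 𝔪 (x * y)
    𝔪-*ʳ (ox , nonunit) oy =
      O-* ox oy , λ (u , ou , xyu≈1) → nonunit (_ , O-* oy ou , trans (sym (*-assoc _ _ _)) xyu≈1)

    𝔪-*ˡ : ∀ {x y} → O x → 𝔪 y → 𝔪 (x * y)
    𝔪-*ˡ ox my = 𝔪-resp (*-comm _ _) (𝔪-*ʳ my ox)

    𝔪-neg : ∀ {x} → 𝔪 x → 𝔪 (- x)
    𝔪-neg {x} mx = 𝔪-resp (trans (sym (-‿distribʳ-* x 1#)) (-‿cong (*-identityʳ x))) (𝔪-*ʳ mx (O-neg O-1))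

    -1∉𝔪 : ¬ 𝔪 (- 1#)
    -1∉𝔪 m-1 = ≈1⇒∉𝔪 (-‿involutive 1#) (𝔪-neg m-1)

    nonunit+multiple≉1 : ∀ {s s′ t} → 𝔪 s → s * s′ ≈ 1# → O (t * s′) → s + t ≈ 1# → ⊥
    nonunit+multiple≉1 {s} {s′} {t} (_ , nonunit) ss′≈1 o s+t≈1 = nonunit (1# + t * s′ , O-+ O-1 o , (begin
      s * (1# + t * s′)   ≈⟨ solve 3 (λ s t s′ → s :* (:1 :+ t :* s′) := s :+ t :* (s :* s′)) refl s t s′ ⟩
      s + t * (s * s′)    ≈⟨ +-congˡ (trans (*-congˡ ss′≈1) (*-identityʳ t)) ⟩
      s + t               ≈⟨ s+t≈1 ⟩
      1#                  ∎))

    -- O is local: of the mutually inverse t s⁻¹ and s t⁻¹ one lies in O.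
    nonunit+nonunit≉1 : ∀ {s t} → 𝔪 s → 𝔪 t → s + t ≈ 1# → ⊥
    nonunit+nonunit≉1 {s} {t} ms mt s+t≈1
      with s′ , ss′≈1 ← inverse s (λ s≈0 → ≈1⇒∉𝔪 (trans (sym (trans (+-congʳ s≈0) (+-identityˡ t))) s+t≈1) mt)
         | t′ , tt′≈1 ← inverse t (λ t≈0 → ≈1⇒∉𝔪 (trans (sym (trans (+-congˡ t≈0) (+-identityʳ s))) s+t≈1) ms)
      with O-val (t * s′) (s * t′) (begin
             (t * s′) * (s * t′) ≈⟨ solve 4 (λ s t s′ t′ → (t :* s′) :* (s :* t′) := (t :* t′) :* (s :* s′)) refl s t s′ t′ ⟩
             (t * t′) * (s * s′) ≈⟨ *-cong tt′≈1 ss′≈1 ⟩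
             1# * 1#             ≈⟨ *-identityʳ 1# ⟩
             1#                  ∎)
    ... | inj₁ o = nonunit+multiple≉1 ms ss′≈1 o s+t≈1
    ... | inj₂ o = nonunit+multiple≉1 mt tt′≈1 o (trans (+-comm t s) s+t≈1)

    𝔪-+ : ∀ {x y} → 𝔪 x → 𝔪 y → 𝔪 (x + y)
    𝔪-+ {x} {y} mx my = O-+ (𝔪⇒O mx) (𝔪⇒O my) , λ (u , ou , [x+y]u≈1) →
      nonunit+nonunit≉1 (𝔪-*ʳ mx ou) (𝔪-*ʳ my ou) (trans (sym (distribʳ u x y)) [x+y]u≈1)

    𝔪-sub : ∀ {x y} → 𝔪 x → 𝔪 y → 𝔪 (x - y)
    𝔪-sub mx my = 𝔪-+ mx (𝔪-neg my)

    ≡ₖ-^ : ∀ {x y} → O x → O y → x ≡ₖ y → ∀ n → (x ^ n) ≡ₖ (y ^ n)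
    ≡ₖ-^ ox oy x≡y zero    = ≈0⇒𝔪 (-‿inverseʳ 1#)
    ≡ₖ-^ {x} {y} ox oy x≡y (suc n) =
      𝔪-resp (solve 4 (λ x y X Y → x :* (X :- Y) :+ (x :- y) :* Y := x :* X :- y :* Y) refl x y (x ^ n) (y ^ n))
        (𝔪-+ (𝔪-*ˡ ox (≡ₖ-^ ox oy x≡y n)) (𝔪-*ʳ x≡y (O-^ n oy)))

    ∉O⇒inverse∈𝔪 : ∀ {x} → ¬ O x → ∃ λ y → 𝔪 y × x * y ≈ 1#
    ∉O⇒inverse∈𝔪 {x} ¬ox with y , xy≈1 ← inverse x (λ x≈0 → ¬ox (O-resp (sym x≈0) O-0))
                          with O-val x y xy≈1
    ... | inj₁ ox = ⊥-elim (¬ox ox)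
    ... | inj₂ oy = y , (oy , λ (u , ou , yu≈1) → ¬ox (O-resp (u≈x u yu≈1) ou)) , xy≈1
      where
      u≈x : ∀ u → y * u ≈ 1# → u ≈ x
      u≈x u yu≈1 = begin
        u            ≈⟨ *-identityˡ u ⟨
        1# * u       ≈⟨ *-congʳ xy≈1 ⟨
        (x * y) * u  ≈⟨ *-assoc x y u ⟩
        x * (y * u)  ≈⟨ *-congˡ yu≈1 ⟩
        x * 1#       ≈⟨ *-identityʳ x ⟩
        x            ∎

    unit-cancel : ∀ {b y} u d → O y → b * y ≈ 1# → (b ^ u) ≡ₖ (b ^ u * b ^ d) → (b ^ d) ≡ₖ 1#
    unit-cancel {b} {y} u d oy by≈1 bᵘ≡bᵘbᵈ = 𝔪-resp (begin
      y ^ u * - (b ^ u - b ^ u * b ^ d)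
        ≈⟨ solve 3 (λ Y B D → Y :* :- (B :- B :* D) := (Y :* B) :* (D :- :1)) refl (y ^ u) (b ^ u) (b ^ d) ⟩
      (y ^ u * b ^ u) * (b ^ d - 1#)
        ≈⟨ *-congʳ (trans (sym (^-distrib-* y b u)) (trans (^-congˡ u (trans (*-comm y b) by≈1)) (1^n≈1 u))) ⟩
      1# * (b ^ d - 1#)                  ≈⟨ *-identityˡ _ ⟩
      b ^ d - 1#                         ∎) (𝔪-*ˡ (O-^ u oy) (𝔪-neg bᵘ≡bᵘbᵈ))

    -- Multiplying f(b) by y^deg f, where b y = 1, gives the reversed polynomial at y.
    monic-reversed : ∀ {as b y} → All O as → O y → b * y ≈ 1# →
                     ∃ λ r → O r × y ^ length as * eval (monic as) b ≈ 1# + y * r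
    monic-reversed {[]} {b} {y} [] oy by≈1 = 0# , O-0 ,
      solve 2 (λ b y → :1 :* (:1 :+ b :* :0) := :1 :+ y :* :0) refl b y
    monic-reversed {a ∷ as} {b} {y} (oa ∷ oas) oy by≈1
      with r , or , eq ← monic-reversed oas oy by≈1 = a * Y + r , O-+ (O-* oa (O-^ (length as) oy)) or , (begin
        (y * Y) * (a + b * P)
          ≈⟨ solve 5 (λ y Y a b P → (y :* Y) :* (a :+ b :* P) := y :* (a :* Y) :+ (b :* y) :* (Y :* P)) refl y Y a b P ⟩
        y * (a * Y) + (b * y) * (Y * P)
          ≈⟨ +-congˡ (*-cong by≈1 eq) ⟩
        y * (a * Y) + 1# * (1# + y * r)
          ≈⟨ solve 4 (λ y Y a r → y :* (a :* Y) :+ :1 :* (:1 :+ y :* r) := :1 :+ y :* (a :* Y :+ r)) refl y Y a r ⟩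
        1# + y * (a * Y + r)              ∎)
      where
      Y = y ^ length as
      P = eval (monic as) b

    root⇒¬¬O : ∀ {as b} → All O as → eval (monic as) b ≈ 0# → ¬ ¬ O b
    root⇒¬¬O {as} {b} oas root ¬ob with y , my , by≈1 ← ∉O⇒inverse∈𝔪 ¬ob
                                   with r , or , eq ← monic-reversed oas (𝔪⇒O my) by≈1 =
      ≈1⇒∉𝔪 1+yr-yr≈1 (𝔪-sub (≈0⇒𝔪 1+yr≈0) (𝔪-*ʳ my or))
      where
      1+yr≈0 : 1# + y * r ≈ 0#
      1+yr≈0 = trans (sym eq) (trans (*-congˡ root) (zeroʳ _))
      1+yr-yr≈1 : (1# + y * r) - y * r ≈ 1#
      1+yr-yr≈1 = solve 2 (λ y r → (:1 :+ y :* r) :- y :* r := :1) refl y r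

    ResidueCharPositive : Set (c ⊔ ℓ ⊔ ℓ′)
    ResidueCharPositive = ∃ λ N → 𝔪 (ι (suc N))

    ι<-≡ₖ⇒residueCharPositive : ∀ {m n} → m < n → ι m ≡ₖ ι n → ResidueCharPositive
    ι<-≡ₖ⇒residueCharPositive {m} {n} m<n ιm≡ιn with N , m+N+1≡n ← ℕ.m≤n⇒∃[o]m+o≡n m<n =
      N , 𝔪-resp ιm-ιn≈-ιN (𝔪-neg ιm≡ιn)
      where
      ιm-ιn≈-ιN : - (ι m - ι n) ≈ ι (suc N)
      ιm-ιn≈-ιN = begin
        - (ι m - ι n)                 ≡⟨ ≡.cong (λ k → - (ι m - ι k)) (≡.trans (ℕ.+-suc m N) m+N+1≡n) ⟨
        - (ι m - ι (m ℕ.+ suc N))     ≈⟨ -‿cong (+-congˡ (-‿cong (ι-+ m (suc N)))) ⟩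
        - (ι m - (ι m + ι (suc N)))   ≈⟨ solve 2 (λ x y → :- (x :- (x :+ y)) := y) refl (ι m) (ι (suc N)) ⟩
        ι (suc N)                     ∎

    residueChar⇒∣ : ∀ {p q} → ResidueChar p → 𝔪 (ι q) → p ∣ q
    residueChar⇒∣ {p@(suc _)} {q} (_ , mp , minimal) mq with q % p in q%p≡r
    ... | zero  = m%n≡0⇒n∣m q p q%p≡r
    ... | suc r = ⊥-elim (minimal (suc r) ℕ.z<s (≡.subst (_< p) q%p≡r (m%n<n q p))
                                  (𝔪-resp ιr≈ (𝔪-sub mq (𝔪-*ˡ (O-ι (q / p)) mp))))
      where
      ιr≈ : ι q - ι (q / p) * ι p ≈ ι (suc r)
      ιr≈ = begin
        ι q - ι (q / p) * ι p
          ≡⟨ ≡.cong (λ k → ι k - ι (q / p) * ι p) (≡.trans (m≡m%n+[m/n]*n q p) (≡.cong (ℕ._+ q / p ℕ.* p) q%p≡r)) ⟩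
        ι (suc r ℕ.+ q / p ℕ.* p) - ι (q / p) * ι p
          ≈⟨ +-congʳ (trans (ι-+ (suc r) (q / p ℕ.* p)) (+-congˡ (ι-* (q / p) p))) ⟩
        (ι (suc r) + ι (q / p) * ι p) - ι (q / p) * ι p
          ≈⟨ solve 2 (λ x y → (x :+ y) :- y := x) refl (ι (suc r)) (ι (q / p) * ι p) ⟩
        ι (suc r)
          ∎

    -- a f′(a) − (M + 1) f(a) = M a + (M + 1) c  for  f = X^(M+1) − X − c.
    trinomial-multipleRoot : ∀ {m a c} → O a → O c →
      𝔪 (eval (monic (trinomial m c)) a) → 𝔪 (evalDeriv (monic (trinomial m c)) a) →
      𝔪 (ι (suc m) * a + ι (2 ℕ.+ m) * c)
    trinomial-multipleRoot {m} {a} {c} oa oc mf mf′ =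
      𝔪-resp (solve 4 (λ a A μ c → a :* ((:1 :+ μ) :* (a :* A) :- :1) :- (:1 :+ μ) :* (a :* (a :* A) :- a :- c)
                                  := μ :* a :+ (:1 :+ μ) :* c) refl a (a ^ m) (ι (suc m)) c)
        (𝔪-sub (𝔪-*ˡ oa (𝔪-resp (evalDeriv-trinomial m c a) mf′))
               (𝔪-*ˡ (O-ι (2 ℕ.+ m)) (𝔪-resp (eval-trinomial m c a) mf)))

    trinomial-multipleRoot⇒𝔪 : ∀ {m a c} → 𝔪 (ι (suc m)) → O a → O c →
      𝔪 (eval (monic (trinomial m c)) a) → 𝔪 (evalDeriv (monic (trinomial m c)) a) → 𝔪 c
    trinomial-multipleRoot⇒𝔪 {m} {a} {c} mM oa oc mf mf′ =
      𝔪-resp (solve 3 (λ μ a c → (μ :* a :+ (:1 :+ μ) :* c) :- μ :* a :- μ :* c := c) refl (ι (suc m)) a c)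
        (𝔪-sub (𝔪-sub (trinomial-multipleRoot {m} oa oc mf mf′) (𝔪-*ʳ mM oa)) (𝔪-*ʳ mM oc))

    -- For c = −1 a multiple root gives M a ≡ M + 1 and (M + 1) a^M ≡ 1,
    -- hence M^M ≡ M^M (M + 1) a^M ≡ (M + 1)^(M+1) in the residue field.
    trinomial-multipleRoot⇒residueCharPositive : ∀ {m a} → O a →
      𝔪 (eval (monic (trinomial m (- 1#))) a) → 𝔪 (evalDeriv (monic (trinomial m (- 1#))) a) →
      ResidueCharPositive
    trinomial-multipleRoot⇒residueCharPositive {m} {a} oa mf mf′ =
      ι<-≡ₖ⇒residueCharPositive {M ℕ.^ M} {suc M ℕ.^ suc M}
        (ℕ.<-≤-trans (ℕ.^-monoˡ-< M (ℕ.n<1+n M)) (ℕ.m≤n*m (suc M ℕ.^ M) (suc M)))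
        (𝔪-resp ιMᴹ≈ (𝔪-+ (𝔪-neg (𝔪-*ˡ (O-^ M (O-ι M)) (𝔪-resp (evalDeriv-trinomial m (- 1#) a) mf′)))
                           (𝔪-*ˡ (O-ι (suc M)) μaᴹ≡μ₁ᴹ)))
      where
      M = suc m
      μ = ι M
      μa≡μ₁ : (μ * a) ≡ₖ (1# + μ)
      μa≡μ₁ = 𝔪-resp (solve 3 (λ μ a c → μ :* a :+ (:1 :+ μ) :* :- :1 := μ :* a :- (:1 :+ μ)) refl μ a (- 1#))
                (trinomial-multipleRoot {m} oa (O-neg O-1) mf mf′)
      μaᴹ≡μ₁ᴹ : (μ ^ M * a ^ M) ≡ₖ ((1# + μ) ^ M)
      μaᴹ≡μ₁ᴹ = 𝔪-resp (+-congʳ (^-distrib-* μ a M)) (≡ₖ-^ (O-* (O-ι M) oa) (O-ι (suc M)) μa≡μ₁ M)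
      ιMᴹ≈ : - (μ ^ M * ((1# + μ) * a ^ M - 1#)) + (1# + μ) * (μ ^ M * a ^ M - (1# + μ) ^ M) ≈
             ι (M ℕ.^ M) - ι (suc M ℕ.^ suc M)
      ιMᴹ≈ = begin
        - (μ ^ M * ((1# + μ) * a ^ M - 1#)) + (1# + μ) * (μ ^ M * a ^ M - (1# + μ) ^ M)
          ≈⟨ solve 4 (λ P μ A Z → :- (P :* ((:1 :+ μ) :* A :- :1)) :+ (:1 :+ μ) :* (P :* A :- Z)
                               := P :- (:1 :+ μ) :* Z) refl (μ ^ M) μ (a ^ M) ((1# + μ) ^ M) ⟩
        μ ^ M - (1# + μ) * (1# + μ) ^ M
          ≈⟨ +-cong (ι-^ M M) (-‿cong (ι-^ (suc M) (suc M))) ⟨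
        ι (M ℕ.^ M) - ι (suc M ℕ.^ suc M) ∎

    multipleRoot⇒discriminant∈𝔪 : ∀ {β γ a} → O β → O a →
      𝔪 (eval (monic (γ ∷ β ∷ [])) a) → 𝔪 (evalDeriv (monic (γ ∷ β ∷ [])) a) → 𝔪 (discriminant β γ)
    multipleRoot⇒discriminant∈𝔪 {β} {γ} {a} oβ oa mf mf′ =
      𝔪-resp (solve 2 (λ s D → s :* s :- (s :* s :- D) := D) refl (ι 2 * a + β) (discriminant β γ))
        (𝔪-resp (+-congˡ (-‿cong (completeSquare β γ a)))
          (𝔪-sub (𝔪-*ʳ (𝔪-resp (evalDeriv-quadratic β γ a) mf′) (O-+ (O-* (O-ι 2) oa) oβ)) (𝔪-*ˡ (O-ι 4) mf)))

    sumSq-ones : ∀ m → sumSq (replicate m 1#) ≈ ι m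
    sumSq-ones zero    = refl
    sumSq-ones (suc m) = +-cong (*-identityˡ 1#) (sumSq-ones m)

    -- A root z of X² + (m + 1) is integral over O, so z² + (m + 1) = 0 would make
    -- −1 ≡ z² + 1² + … + 1² a sum of squares in the residue field.
    formallyReal⇒square+ι≉0 : (∀ xs → All O xs → ¬ 𝔪 (sumSq xs + 1#)) →
                              ∀ z m → z * z + ι (suc m) ≈ 0# → ⊥
    formallyReal⇒square+ι≉0 formallyReal z m z²+m+1≈0 =
      root⇒¬¬O (O-ι (suc m) ∷ O-0 ∷ []) (trans root≈ z²+m+1≈0) λ oz →
        formallyReal (z ∷ replicate m 1#) (oz ∷ All.replicate⁺ m O-1) (≈0⇒𝔪 (trans sumSq≈ z²+m+1≈0))
      where
      root≈ : eval (monic (ι (suc m) ∷ 0# ∷ [])) z ≈ z * z + ι (suc m)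
      root≈ = solve 2 (λ z N → N :+ z :* (:0 :+ z :* (:1 :+ z :* :0)) := z :* z :+ N) refl z (ι (suc m))
      sumSq≈ : sumSq (z ∷ replicate m 1#) + 1# ≈ z * z + ι (suc m)
      sumSq≈ = trans (+-congʳ (+-congˡ (sumSq-ones m)))
                     (solve 2 (λ z N → (z :* z :+ N) :+ :1 := z :* z :+ (:1 :+ N)) refl z (ι m))

    formallyReal⇒rootless : (∀ xs → All O xs → ¬ 𝔪 (sumSq xs + 1#)) →
      ∀ {β γ} m → discriminant β γ ≈ - ι (suc m) → ∀ b → eval (monic (γ ∷ β ∷ [])) b ≈ 0# → ⊥
    formallyReal⇒rootless formallyReal {β} {γ} m Δ≈ b root = formallyReal⇒square+ι≉0 formallyReal s m (begin
      s * s + ι (suc m)                ≈⟨ +-congˡ (trans (sym (-‿involutive _)) (-‿cong (sym Δ≈))) ⟩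
      s * s - discriminant β γ         ≈⟨ completeSquare β γ b ⟨
      ι 4 * eval (monic (γ ∷ β ∷ [])) b ≈⟨ *-congˡ root ⟩
      ι 4 * 0#                         ≈⟨ zeroʳ _ ⟩
      0#                               ∎)
      where s = ι 2 * b + β

    module FiniteResidue (finite : ResidueFinite) where
      n : ℕ
      n = proj₁ finite

      representative : Fin n → Res
      representative = proj₁ (proj₂ finite)

      representative-surjective : ∀ x → ∃ λ k → representative k ≈ᵣ x
      representative-surjective = proj₂ (proj₂ finite)

      classOf : ∀ {x} → O x → Fin n
      classOf {x} ox = proj₁ (representative-surjective (x , ox))

      classOf-≡ₖ : ∀ {x} (ox : O x) → proj₁ (representative (classOf ox)) ≡ₖ x
      classOf-≡ₖ {x} ox = proj₂ (representative-surjective (x , ox))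

      residuePigeonhole : (x : Fin (suc n) → Carrier) → (∀ i → O (x i)) →
                          ∃₂ λ i j → i Fin.< j × x i ≡ₖ x j
      residuePigeonhole x ox with i , j , i<j , same ← pigeonhole (ℕ.n<1+n n) (λ i → classOf (ox i)) =
        i , j , i<j , 𝔪-resp (solve 3 (λ r xi xj → (r :- xj) :- (r :- xi) := xi :- xj) refl _ (x i) (x j))
                        (𝔪-sub (≡.subst (λ k → proj₁ (representative k) ≡ₖ x j) (≡.sym same) (classOf-≡ₖ (ox j)))
                               (classOf-≡ₖ (ox i)))

      unit-order : ∀ {b y} → O b → O y → b * y ≈ 1# → ∃ λ d → suc d ℕ.≤ n × (b ^ suc d) ≡ₖ 1#
      unit-order {b} {y} ob oy by≈1 =
        period (residuePigeonhole (λ i → b ^ suc (toℕ i)) (λ i → O-^ (suc (toℕ i)) ob))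
        where
        period : (∃₂ λ i j → i Fin.< j × (b ^ suc (toℕ i)) ≡ₖ (b ^ suc (toℕ j))) →
                 ∃ λ d → suc d ℕ.≤ n × (b ^ suc d) ≡ₖ 1#
        period (i , j , i<j , bⁱ≡bʲ) =
          d , d+1≤n , unit-cancel (suc (toℕ i)) (suc d) oy by≈1 (𝔪-resp (+-congˡ (-‿cong bʲ≈)) bⁱ≡bʲ)
          where
          d = proj₁ (ℕ.m≤n⇒∃[o]m+o≡n i<j)
          i+1+d≡j : suc (toℕ i) ℕ.+ d ≡ toℕ j
          i+1+d≡j = proj₂ (ℕ.m≤n⇒∃[o]m+o≡n i<j)
          d+1≤n : suc d ℕ.≤ n
          d+1≤n = ℕ.≤-trans (ℕ.s≤s (ℕ.m≤n+m d (toℕ i))) (≡.subst (ℕ._≤ n) (≡.sym i+1+d≡j) (toℕ≤pred[n] j))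
          bʲ≈ : b ^ suc (toℕ j) ≈ b ^ suc (toℕ i) * b ^ suc d
          bʲ≈ = trans (^-congʳ b (≡.trans (≡.cong suc (≡.sym i+1+d≡j)) (≡.sym (ℕ.+-suc (suc (toℕ i)) d))))
                      (^-homo-* b (suc (toℕ i)) (suc d))

      ^≡ₖ1-multiple : ∀ {x d M} → O x → (x ^ d) ≡ₖ 1# → d ∣ M → (x ^ M) ≡ₖ 1#
      ^≡ₖ1-multiple {x} {d} ox xᵈ≡1 (divides t M≡td) =
        𝔪-resp (+-cong (trans (^-assocʳ x d t) (^-congʳ x (≡.trans (ℕ.*-comm d t) (≡.sym M≡td)))) (-‿cong (1^n≈1 t)))
          (≡ₖ-^ (O-^ d ox) O-1 xᵈ≡1 t)

      unit⇒^≡ₖ1 : ∀ {b y M} → O b → O y → b * y ≈ 1# → n ! ∣ M → (b ^ M) ≡ₖ 1#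
      unit⇒^≡ₖ1 ob oy by≈1 n!∣M =
        let d , d+1≤n , bᵈ⁺¹≡1 = unit-order ob oy by≈1
        in ^≡ₖ1-multiple ob bᵈ⁺¹≡1 (∣-trans (m∣m*n {suc d} (d !)) (∣-trans (m≤n⇒m!∣n! d+1≤n) n!∣M))

      -- Either b ∈ 𝔪 or b is a unit; as 𝔪-membership is ¬¬-stable, no decision is needed.
      fermat : ∀ {b M} → O b → n ! ∣ M → (b * b ^ M) ≡ₖ b
      fermat {b} {M} ob n!∣M = 𝔪-stable (O-sub (O-* ob (O-^ M ob)) ob) λ ¬fermat →
        let mb : 𝔪 b
            mb = ob , λ (y , oy , by≈1) → ¬fermat (unit-case oy by≈1)
        in ¬fermat (𝔪-sub (𝔪-*ʳ mb (O-^ M ob)) mb)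
        where
        unit-case : ∀ {y} → O y → b * y ≈ 1# → (b * b ^ M) ≡ₖ b
        unit-case oy by≈1 = 𝔪-resp (solve 2 (λ b X → b :* (X :- :1) := b :* X :- b) refl b (b ^ M))
                              (𝔪-*ˡ ob (unit⇒^≡ₖ1 ob oy by≈1 n!∣M))

      n!∣1+pred[n!] : n ! ∣ suc (ℕ.pred (n !))
      n!∣1+pred[n!] = ≡.subst (n ! ∣_) (≡.sym (ℕ.suc-pred (n !) {{n ℕ.!≢0}})) ∣-refl

      trinomial-rootless : ∀ m {c} → n ! ∣ suc m → O c → ¬ 𝔪 c →
                           ∀ b → eval (monic (trinomial m c)) b ≈ 0# → ⊥
      trinomial-rootless m {c} n!∣M oc ¬mc b root =
        root⇒¬¬O (O-trinomial m oc) root λ ob →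
          ¬mc (𝔪-resp (solve 3 (λ b X c → (b :* X :- b) :- (b :* X :- b :- c) := c) refl b (b ^ suc m) c)
                 (𝔪-sub (fermat ob n!∣M) (≈0⇒𝔪 (trans (sym (eval-trinomial m c b)) root))))

    module _ (henselian : Henselian) where

      simpleRoot⇒root : ∀ {x y ys} → O x → O y → All O ys → 𝔪 x → ¬ 𝔪 y →
                        ∃ λ b → eval (monic (x ∷ y ∷ ys)) b ≈ 0#
      simpleRoot⇒root {x} {y} {ys} ox oy oys mx ¬my =
        let b , _ , root , _ = henselian (x ∷ y ∷ ys) (ox ∷ oy ∷ oys) 0# O-0
                                 (𝔪-resp (sym (eval-0 x (monic (y ∷ ys)))) mx)
                                 (λ m → ¬my (𝔪-resp (trans (eval-deriv-0 x (monic (y ∷ ys))) (eval-0 y (monic ys))) m))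
        in b , root

      -- Hensel's lemma is applied at 0 to the Taylor shift f(X + a): deriv is defined through a
      -- private helper and can only be computed at 0, where it is the linear coefficient.
      rootless⇒multipleResidueRoot : ResidueAlgClosed → ∀ as → All O as → 0 < length as →
        (∀ b → eval (monic as) b ≈ 0# → ⊥) →
        ∃ λ a → O a × 𝔪 (eval (monic as) a) × 𝔪 (evalDeriv (monic as) a)
      rootless⇒multipleResidueRoot algClosed as oas deg>0 rootless =
        let a , oa , mfa = algClosed as oas deg>0 in
        a , oa , mfa , 𝔪-stable (O-evalDeriv (O-monic oas) oa) λ ¬mf′a →
            let b , _ , root , _ = henselian (taylor a as) (O-taylor oa oas) 0# O-0
                                     (𝔪-resp (sym (trans (eval-taylor a as 0#) (eval-cong (monic as) (+-identityˡ a)))) mfa)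
                                     (λ m → ¬mf′a (𝔪-resp (deriv₀-taylor a as) m))
            in rootless (b + a) (trans (sym (eval-taylor a as b)) root)

      rootless⇒discriminant∈𝔪 : ResidueAlgClosed → ∀ {β γ} → O β → O γ →
        (∀ b → eval (monic (γ ∷ β ∷ [])) b ≈ 0# → ⊥) → 𝔪 (discriminant β γ)
      rootless⇒discriminant∈𝔪 algClosed {β} {γ} oβ oγ rootless =
        let a , oa , mf , mf′ = rootless⇒multipleResidueRoot algClosed (γ ∷ β ∷ []) (oγ ∷ oβ ∷ [])
                                                             (ℕ.s≤s ℕ.z≤n) rootless
        in multipleRoot⇒discriminant∈𝔪 {β} {γ} {a} oβ oa mf mf′

  -- X^(M+1) − X + 1 is rootless for n! ∣ M.  With M = n! its multiple residue root for V gives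
  -- a residue characteristic N, and then with M = n! N it gives −1 ∈ 𝔪.
  ACVF-like⇒¬somePCF-like : ∀ {ℓ₁ ℓ₂} → ACVF-like ℓ₁ → somePCF-like ℓ₂ → ⊥
  ACVF-like⇒¬somePCF-like (_ , V , henselV , algClosed) (_ , _ , _ , W , _ , finite , _) =
    let a₁ , oa₁ , mf₁ , mf₁′ = multipleRoot m₁ W.n!∣1+pred[n!]
        N , mN = V.trinomial-multipleRoot⇒residueCharPositive {m₁} oa₁ mf₁ mf₁′
        m₂ = N ℕ.+ m₁ ℕ.* suc N
        a₂ , oa₂ , mf₂ , mf₂′ = multipleRoot m₂ (∣-trans W.n!∣1+pred[n!] (m∣m*n (suc N)))
        mM₂ = V.𝔪-resp (sym (ι-* (suc m₁) (suc N))) (V.𝔪-*ˡ (V.O-ι (suc m₁)) mN)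
    in V.-1∉𝔪 (V.trinomial-multipleRoot⇒𝔪 {m₂} mM₂ oa₂ (V.O-neg V.O-1) mf₂ mf₂′)
    where
    module V = Valuation V
    module W where
      open Valuation W public
      open FiniteResidue finite public
    m₁ = ℕ.pred (W.n !)
    multipleRoot : ∀ m → W.n ! ∣ suc m → ∃ λ a → V.O a ×
      V.𝔪 (eval (monic (trinomial m (- 1#))) a) × V.𝔪 (evalDeriv (monic (trinomial m (- 1#))) a)
    multipleRoot m n!∣M = V.rootless⇒multipleResidueRoot henselV algClosed (trinomial m (- 1#))
      (V.O-trinomial m (V.O-neg V.O-1)) (ℕ.s≤s ℕ.z≤n) (W.trinomial-rootless m n!∣M (W.O-neg W.O-1) W.-1∉𝔪)

  -- X² + 1 and X² + X + 1 have discriminants −4 and −3, so both are rootless;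
  -- in the residue field of V both discriminants then vanish, and so does their difference 1.
  ACVF-like⇒¬RCVF-like : ∀ {ℓ₁ ℓ₂} → ACVF-like ℓ₁ → RCVF-like ℓ₂ → ⊥
  ACVF-like⇒¬RCVF-like (_ , V , henselV , algClosed) (_ , W , _ , formallyReal , _) =
    V.≈1⇒∉𝔪 Δ₁-Δ₀≈1 (V.𝔪-sub (discriminant∈𝔪 V.O-1 2 Δ₁≈) (discriminant∈𝔪 V.O-0 3 Δ₀≈))
    where
    module V = Valuation V
    discriminant∈𝔪 : ∀ {β} → V.O β → ∀ m → discriminant β 1# ≈ - ι (suc m) → V.𝔪 (discriminant β 1#)
    discriminant∈𝔪 oβ m Δ≈ = V.rootless⇒discriminant∈𝔪 henselV algClosed oβ V.O-1
      (Valuation.formallyReal⇒rootless W formallyReal m Δ≈)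
    Δ₀≈ : discriminant 0# 1# ≈ - ι 4
    Δ₀≈ = solve 0 (:0 :* :0 :- :ι 4 :* :1 := :- :ι 4) refl
    Δ₁≈ : discriminant 1# 1# ≈ - ι 3
    Δ₁≈ = solve 0 (:1 :* :1 :- :ι 4 :* :1 := :- :ι 3) refl
    Δ₁-Δ₀≈1 : discriminant 1# 1# - discriminant 0# 1# ≈ 1#
    Δ₁-Δ₀≈1 = trans (+-cong Δ₁≈ (-‿cong Δ₀≈)) (solve 0 (:- :ι 3 :- :- :ι 4 := :1) refl)

  somePCF-like⇒¬RCVF-like : ∀ {ℓ₁ ℓ₂} → somePCF-like ℓ₁ → RCVF-like ℓ₂ → ⊥
  somePCF-like⇒¬RCVF-like (zero , _ , _ , _ , _ , _ , () , _) _
  somePCF-like⇒¬RCVF-like (p@(suc p′) , _ , _ , W , henselW , _ , _ , mp , _) (_ , V , _ , formallyReal , _) =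
    let b , root = W.simpleRoot⇒root henselW (W.O-ι p) W.O-1 [] mp (W.≈1⇒∉𝔪 refl)
    in Valuation.formallyReal⇒rootless V formallyReal (2 ℕ.+ 4 ℕ.* p′) Δ≈ b root
    where
    module W = Valuation W
    Δ≈ : discriminant 1# (ι p) ≈ - ι (3 ℕ.+ 4 ℕ.* p′)
    Δ≈ = trans (solve 1 (λ P → :1 :* :1 :- :ι 4 :* (:1 :+ P)
                             := :- (:1 :+ (:1 :+ (:1 :+ :ι 4 :* P)))) refl (ι p′))
               (-‿cong (+-congˡ (+-congˡ (+-congˡ (sym (ι-* 4 p′))))))

  pCF-like-unique : ∀ {ℓ₁ ℓ₂} p q → Prime p → Prime q → pCF-like ℓ₁ p → pCF-like ℓ₂ q → p ≡ q
  pCF-like-unique p q _ q-prime (_ , W₁ , _ , finite , charp) (_ , W₂ , henselW₂ , _ , charq) =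
    [ (λ p≡1 → ⊥-elim (W₁.≈1⇒∉𝔪 (+-identityʳ 1#) (≡.subst (λ k → W₁.𝔪 (ι k)) p≡1 (proj₁ (proj₂ charp)))))
    , id
    ]′
      (prime⇒irreducible q-prime (W₁.residueChar⇒∣ charp ιq∈𝔪₁))
    where
    module W₁ where
      open Valuation W₁ public
      open FiniteResidue finite public
    module W₂ = Valuation W₂
    m = ℕ.pred (W₁.n !)
    -- X^(M+1) − X − q has the simple residue root 0 for W₂, hence a root in K,
    -- which for W₁ forces q ≡ 0.
    ιq∈𝔪₁ : W₁.𝔪 (ι q)
    ιq∈𝔪₁ = W₁.𝔪-stable (W₁.O-ι q) λ ¬mq →
      let b , root = W₂.simpleRoot⇒root henselW₂ (W₂.O-neg (W₂.O-ι q)) (W₂.O-neg W₂.O-1) (All.replicate⁺ m W₂.O-0)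
                                         (W₂.𝔪-neg (proj₁ (proj₂ charq))) W₂.-1∉𝔪
      in W₁.trinomial-rootless m W₁.n!∣1+pred[n!] (W₁.O-ι q) ¬mq b root

proposition5p3 : ∀ {c ℓ : Level} (K : Field c ℓ) (ℓ₁ ℓ₂ : Level) →
    FieldTheory.Infinite K →
    ¬ (FieldTheory.ACVF-like K ℓ₁ × FieldTheory.somePCF-like K ℓ₂) ×
    ¬ (FieldTheory.ACVF-like K ℓ₁ × FieldTheory.RCVF-like K ℓ₂) ×
    ¬ (FieldTheory.somePCF-like K ℓ₁ × FieldTheory.RCVF-like K ℓ₂) ×
    (∀ (p q : ℕ) → Prime p → Prime q →
      FieldTheory.pCF-like K ℓ₁ p → FieldTheory.pCF-like K ℓ₂ q → p ≡ q)
proposition5p3 K ℓ₁ ℓ₂ _ =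
  (λ (acvf , pcf) → ACVF-like⇒¬somePCF-like K acvf pcf) ,
  (λ (acvf , rcvf) → ACVF-like⇒¬RCVF-like K acvf rcvf) ,
  (λ (pcf , rcvf) → somePCF-like⇒¬RCVF-like K pcf rcvf) ,
  pCF-like-unique K
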